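{- Let $k\geq 3$ be an integer and let $\theta_k(n)$ denote the number of permutations of $1,\dots,n$ that avoid arithmetic progressions of length $k$. For every $\epsilon>0$, $\theta_k(n)\geq (k-1)!^{\left(\frac{1}{k-2}-\epsilon\right)n}$ whenever $n$ is a sufficiently large power of $k-1$.
   Context: A permutation $p_1,\dots,p_n$ of $1,\dots,n$ contains an arithmetic progression of length $k$ if there are indices $i_1<\dots<i_k$ and integers $a$ and $d\neq 0$ (possibly negative) with $p_{i_j}=a+(j-1)d$ for all $j$. It avoids such progressions otherwise.
   Formalization: The parameter ε ranges only over the positive rationals. -}

module Defs where

open import Data.Nat as ℕ using (ℕ; suc; _∸_; _^_; _≤_; _!)

open import Data.Fin as Fin using (Fin; toℕ)
open import Data.Integer as ℤ using (ℤ; +_)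
open import Data.Vec using (Vec; lookup)
open import Data.Product using (Σ; ∃; ∃-syntax; _×_)
open import Relation.Binary.PropositionalEquality using (_≡_; _≢_)
open import Relation.Nullary using (¬_)
open import Function.Definitions using (Injective)

-- A permutation p₁,…,pₙ of 1,…,n is a vector of length n of elements of
-- Fin n (entry j encodes the value toℕ j + 1) whose entries are pairwise
-- distinct (an injective map Fin n → Fin n, hence a bijection).
IsPerm : {n : ℕ} → Vec (Fin n) n → Set
IsPerm v = Injective _≡_ _≡_ (lookup v)

val : {n : ℕ} → Vec (Fin n) n → Fin n → ℤ
val v i = + suc (toℕ (lookup v i))

ContainsAP : (k : ℕ) {n : ℕ} → Vec (Fin n) n → Set
ContainsAP k {n} v =
  Σ (Fin k → Fin n) λ idx →
    (∀ j j′ → j Fin.< j′ → idx j Fin.< idx j′) ×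
    ∃[ a ] ∃[ d ] (d ≢ + 0 ×
      (∀ j → val v (idx j) ≡ a ℤ.+ (+ toℕ j) ℤ.* d))

AvoidsAP : (k : ℕ) {n : ℕ} → Vec (Fin n) n → Set
AvoidsAP k v = ¬ ContainsAP k v

θ≥ : (k n M : ℕ) → Set
θ≥ k n M =
  Σ (Vec (Vec (Fin n) n) M) λ ps →
    Injective _≡_ _≡_ (lookup ps) ×
    (∀ j → IsPerm (lookup ps j) × AvoidsAP k (lookup ps j))

-- For ε = a/b (a, b > 0) the real exponent (1/(k-2) - ε)·n equals
-- P/D with D = b(k-2) and P = (b - a(k-2))·n = P⁺ - P⁻.
-- The inequality  x ≥ F^(P/D)  for a natural number x ≥ 0 and F ≥ 1 is
-- equivalent to  x^D · F^P⁻ ≥ F^P⁺.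
expDen : (k a b : ℕ) → ℕ
expDen k a b = b ℕ.* (k ∸ 2)

expPos : (k a b n : ℕ) → ℕ
expPos k a b n = (b ℕ.* n) ∸ (a ℕ.* (k ∸ 2) ℕ.* n)

expNeg : (k a b n : ℕ) → ℕ
expNeg k a b n = (a ℕ.* (k ∸ 2) ℕ.* n) ∸ (b ℕ.* n)

-- "θ_k(n) ≥ (k-1)!^((1/(k-2) - a/b) n)"
BoundHolds : (k a b n : ℕ) → Set
BoundHolds k a b n =
  ∃[ M ] (θ≥ k n M ×
    (((k ∸ 1) !) ^ expPos k a b n) ≤ (M ^ expDen k a b) ℕ.* (((k ∸ 1) !) ^ expNeg k a b n))

module Submission where

-- Proof idea: the product ("blow-up") construction, with q = k - 1.
-- For a permutation σ of Fin q and permutations g₀,…,g_{q-1} of Fin n,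
-- the blow-up σ[g] is the permutation of Fin (q·n) sending position
-- n·t + i (block t, offset i) to the value q·g_t(i) + σ(t).  If every g_t
-- avoids k-term progressions, so does σ[g]: the first and last terms of a
-- k-term progression differ by q·d, so their values have the same residue
-- σ(t) mod q and lie in the same block; blocks are ordered, so the whole
-- progression lies in one block t, and the quotients of its values by q
-- form a progression in g_t.  Starting from the one-point permutation,
-- m blow-ups give q!^levels(m) distinct avoiding permutations of Fin (q^m),
-- where levels(m)·(k-2) + 1 = q^m, and this count beats the required bound
-- as soon as q^m ≥ b.

open import Defs
open import Data.Nat using (ℕ; _∸_; _^_; _≤_; _<_; zero; suc; _+_; _*_; _!; z≤n; s≤s; NonZero)
import Data.Nat.Properties as NP
open import Algebra.Properties.CommutativeSemigroup NP.+-commutativeSemigroup using (xy∙z≈xz∙y)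
open import Data.Nat.DivMod using (_%_; [m+kn]%n≡m%n; m<n⇒m%n≡m)
open import Data.Nat.Tactic.RingSolver using (solve-∀)
import Data.Integer.Tactic.RingSolver as ℤ-Solver
open import Data.Fin as F
  using (Fin; toℕ; combine; quotient; remainder; punchIn; cast; finToFun; funToFin)
import Data.Fin.Properties as FP
open import Data.Integer as Z using (ℤ; +_; -[1+_])
import Data.Integer.Properties as ZP
open import Data.Vec using (Vec; lookup; tabulate)
open import Data.Vec.Properties using (lookup∘tabulate)
open import Data.Product using (∃-syntax; Σ; _×_; _,_; proj₁; proj₂)
open import Data.Sum using (inj₁; inj₂)
open import Function using (id; _∘_)
open import Function.Definitions using (Injective)
open import Relation.Binary.PropositionalEquality
open import Relation.Nullary using (¬_; contradiction)

Fn : ℕ → Set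
Fn n = Fin n → Fin n

Increasing : ∀ {l n} → (Fin l → Fin n) → Set
Increasing idx = ∀ j j′ → j F.< j′ → idx j F.< idx j′

-- f contains an (l+1)-term progression: increasing positions idx j whose
-- values are f(idx 0) + j·(B - A) with A ≢ B, written without subtraction.
HasProgression : (l : ℕ) {n : ℕ} → Fn n → Set
HasProgression l {n} f = Σ (Fin (suc l) → Fin n) λ idx → Increasing idx ×
  ∃[ A ] ∃[ B ] (A ≢ B ×
    (∀ j → toℕ (f (idx j)) + toℕ j * A ≡ toℕ (f (idx F.zero)) + toℕ j * B))

-- An integer step d ≢ 0 is encoded by two distinct naturals A, B with
-- d = B - A, so that x = y + j·d becomes x + j·A = y + j·B.
stepAsDifference : (d : ℤ) → d ≢ + 0 →
  ∃[ A ] ∃[ B ] (A ≢ B × (∀ x y j → + x ≡ + y Z.+ (+ j) Z.* d → x + j * A ≡ y + j * B))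
stepAsDifference (+ zero) d≢0 = contradiction refl d≢0
stepAsDifference (+ suc D) _ = 0 , suc D , (λ ()) , λ x y j eq → begin
  x + j * 0           ≡⟨ cong (λ z → x + z) (NP.*-zeroʳ j) ⟩
  x + 0               ≡⟨ NP.+-identityʳ x ⟩
  x                   ≡⟨ ZP.+-injective (trans eq (cong (λ z → + y Z.+ z) (sym (ZP.pos-* j (suc D))))) ⟩
  y + j * suc D       ∎
  where open ≡-Reasoning
stepAsDifference -[1+ D ] _ = suc D , 0 , (λ ()) , λ x y j eq → ZP.+-injective (begin
  + (x + j * suc D)                            ≡⟨ ZP.pos-+ x (j * suc D) ⟩
  + x Z.+ + (j * suc D)                        ≡⟨ cong (λ z → z Z.+ + (j * suc D)) eq ⟩
  + y Z.+ (+ j) Z.* -[1+ D ] Z.+ + (j * suc D) ≡⟨ cong (λ z → + y Z.+ z Z.+ + (j * suc D)) (negatedProduct j) ⟩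
  + y Z.- + (j * suc D) Z.+ + (j * suc D)      ≡⟨ cancel (+ y) (+ (j * suc D)) ⟩
  + y                                          ≡⟨ cong +_ (sym (trans (cong (λ z → y + z) (NP.*-zeroʳ j)) (NP.+-identityʳ y))) ⟩
  + (y + j * 0)                                ∎)
  where
  open ≡-Reasoning
  negatedProduct : ∀ j → (+ j) Z.* -[1+ D ] ≡ Z.- + (j * suc D)
  negatedProduct j = trans (sym (ZP.neg-distribʳ-* (+ j) (+ suc D))) (cong Z.-_ (sym (ZP.pos-* j (suc D))))
  cancel : ∀ y c → y Z.- c Z.+ c ≡ y
  cancel = ℤ-Solver.solve-∀

containsAP⇒hasProgression : ∀ {l n} (f : Fn n) → ContainsAP (suc l) (tabulate f) → HasProgression l f
containsAP⇒hasProgression {l} f (idx , incr , a , d , d≢0 , onProgression)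
  with stepAsDifference d d≢0
... | A , B , A≢B , inℕ =
  idx , incr , A , B , A≢B , λ j → NP.suc-injective (inℕ (suc (X j)) (suc (X F.zero)) (toℕ j) (shifted j))
  where
  X : Fin (suc l) → ℕ
  X j = toℕ (f (idx j))
  value : ∀ j → + suc (X j) ≡ a Z.+ (+ toℕ j) Z.* d
  value j = trans (cong (λ z → + suc (toℕ z)) (sym (lookup∘tabulate f (idx j)))) (onProgression j)
  firstTerm : a ≡ + suc (X F.zero)
  firstTerm = sym (trans (value F.zero) (ZP.+-identityʳ a))
  shifted : ∀ j → + suc (X j) ≡ + suc (X F.zero) Z.+ (+ toℕ j) Z.* d
  shifted j = trans (value j) (cong (λ z → z Z.+ (+ toℕ j) Z.* d) firstTerm)

residues-equal : ∀ q .{{_ : NonZero q}} {r r′} x y → r < q → r′ < q →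
  r + x * q ≡ r′ + y * q → r ≡ r′
residues-equal q {r} {r′} x y r<q r′<q eq = begin
  r                 ≡⟨ m<n⇒m%n≡m r<q ⟨
  r % q             ≡⟨ [m+kn]%n≡m%n r x q ⟨
  (r + x * q) % q   ≡⟨ cong (_% q) eq ⟩
  (r′ + y * q) % q  ≡⟨ [m+kn]%n≡m%n r′ y q ⟩
  r′ % q            ≡⟨ m<n⇒m%n≡m r′<q ⟩
  r′                ∎
  where open ≡-Reasoning

residueForm : ∀ q w r a → q * w + r + q * a ≡ r + (w + a) * q
residueForm = solve-∀

progression-quotient : ∀ q .{{_ : NonZero q}} {l} (W : Fin (suc (suc l)) → ℕ) A B → A ≢ B →
  (∀ j → q * W j + toℕ j * A ≡ q * W F.zero + toℕ j * B) →
  W F.zero ≢ W (F.suc F.zero) × (∀ j → W j + toℕ j * W F.zero ≡ W F.zero + toℕ j * W (F.suc F.zero))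
progression-quotient q W A B A≢B prog = W₀≢W₁ , divided
  where
  W₀ W₁ : ℕ
  W₀ = W F.zero
  W₁ = W (F.suc F.zero)
  second : q * W₁ + A ≡ q * W₀ + B
  second = subst₂ (λ u v → q * W₁ + u ≡ q * W₀ + v) (NP.*-identityˡ A) (NP.*-identityˡ B) (prog (F.suc F.zero))
  W₀≢W₁ : W₀ ≢ W₁
  W₀≢W₁ W₀≡W₁ = A≢B (NP.+-cancelˡ-≡ (q * W₀) A B (subst (λ w → q * w + A ≡ q * W₀ + B) (sym W₀≡W₁) second))
  divided : ∀ j → W j + toℕ j * W₀ ≡ W₀ + toℕ j * W₁
  divided j = NP.*-cancelˡ-≡ _ _ q (NP.+-cancelʳ-≡ (toℕ j * (q * W₀ + B)) _ _ (begin
    q * (W j + i * W₀) + i * (q * W₀ + B)  ≡⟨ cong (λ z → q * (W j + i * W₀) + i * z) second ⟨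
    q * (W j + i * W₀) + i * (q * W₁ + A)  ≡⟨ regroupˡ q (W j) W₀ W₁ i A ⟩
    (q * W j + i * A) + i * q * (W₀ + W₁)  ≡⟨ cong (λ z → z + i * q * (W₀ + W₁)) (prog j) ⟩
    (q * W₀ + i * B) + i * q * (W₀ + W₁)   ≡⟨ regroupʳ q W₀ W₁ i B ⟩
    q * (W₀ + i * W₁) + i * (q * W₀ + B)   ∎))
    where
    open ≡-Reasoning
    i : ℕ
    i = toℕ j
    regroupˡ : ∀ q w w₀ w₁ i a → q * (w + i * w₀) + i * (q * w₁ + a) ≡ (q * w + i * a) + i * q * (w₀ + w₁)
    regroupˡ = solve-∀
    regroupʳ : ∀ q w₀ w₁ i b → (q * w₀ + i * b) + i * q * (w₀ + w₁) ≡ q * (w₀ + i * w₁) + i * (q * w₀ + b)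
    regroupʳ = solve-∀

remQuot-injective : ∀ {m} n {x y : Fin (m * n)} →
  quotient {m} n x ≡ quotient {m} n y → remainder {m} n x ≡ remainder {m} n y → x ≡ y
remQuot-injective {m} n {x} {y} q≡ r≡ =
  trans (sym (FP.combine-remQuot {m} n x)) (trans (cong₂ combine q≡ r≡) (FP.combine-remQuot {m} n y))

funToFin-cong : ∀ {m n} {f g : Fin m → Fin n} → (∀ i → f i ≡ g i) → funToFin f ≡ funToFin g
funToFin-cong {zero} f≗g = refl
funToFin-cong {suc m} f≗g = cong₂ combine (f≗g F.zero) (funToFin-cong (f≗g ∘ F.suc))

finToFun-injective : ∀ {m n} {x y : Fin (n ^ m)} → (∀ i → finToFun {n} {m} x i ≡ finToFun y i) → x ≡ y
finToFun-injective {m} {n} {x} {y} x≗y =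
  trans (sym (FP.funToFin-finToFin {m} {n} x)) (trans (funToFin-cong {m} {n} x≗y) (FP.funToFin-finToFin {m} {n} y))

-- Lehmer code: every element of Fin (s !) codes a permutation of Fin s,
-- first the image of 0, then (via punchIn) a permutation of the rest.
lehmer : ∀ s → Fin (s !) → Fn s
lehmer (suc s) x F.zero    = quotient (s !) x
lehmer (suc s) x (F.suc j) = punchIn (quotient (s !) x) (lehmer s (remainder {suc s} (s !) x) j)

lehmer-permutation : ∀ s x → Injective _≡_ _≡_ (lehmer s x)
lehmer-permutation (suc s) x {F.zero}  {F.zero}  _  = refl
lehmer-permutation (suc s) x {F.zero}  {F.suc j} eq = contradiction (sym eq) (FP.punchInᵢ≢i _ _)
lehmer-permutation (suc s) x {F.suc i} {F.zero}  eq = contradiction eq (FP.punchInᵢ≢i _ _)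
lehmer-permutation (suc s) x {F.suc i} {F.suc j} eq =
  cong F.suc (lehmer-permutation s _ (FP.punchIn-injective _ _ _ eq))

lehmer-injective : ∀ s {x y} → (∀ j → lehmer s x j ≡ lehmer s y j) → x ≡ y
lehmer-injective zero {F.zero} {F.zero} _ = refl
lehmer-injective (suc s) {x} {y} x≗y =
  remQuot-injective {suc s} (s !) first (lehmer-injective s rest)
  where
  first : quotient (s !) x ≡ quotient (s !) y
  first = x≗y F.zero
  rest : ∀ j → lehmer s (remainder {suc s} (s !) x) j ≡ lehmer s (remainder {suc s} (s !) y) j
  rest j = FP.punchIn-injective (quotient (s !) x) _ _
    (trans (x≗y (F.suc j)) (cong (λ z → punchIn z (lehmer s (remainder {suc s} (s !) y) j)) (sym first)))

cast-injective : ∀ {m n} .(eq : m ≡ n) {x y : Fin m} → cast eq x ≡ cast eq y → x ≡ y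
cast-injective eq {x} {y} cx≡cy =
  FP.toℕ-injective (trans (sym (FP.toℕ-cast eq x)) (trans (cong toℕ cx≡cy) (FP.toℕ-cast eq y)))

increasing-monotone : ∀ {l n} {idx : Fin l → Fin n} → Increasing idx →
  ∀ {j j′} → j F.≤ j′ → idx j F.≤ idx j′
increasing-monotone {idx = idx} incr {j} {j′} j≤j′ with NP.m≤n⇒m<n∨m≡n j≤j′
... | inj₁ j<j′ = NP.<⇒≤ (incr j j′ j<j′)
... | inj₂ j≡j′ = NP.≤-reflexive (cong (toℕ ∘ idx) (FP.toℕ-injective j≡j′))

quotient-monotone : ∀ {m} n {x y : Fin (m * n)} → x F.≤ y → quotient {m} n x F.≤ quotient {m} n y
quotient-monotone {m} n {x} {y} x≤y = NP.≮⇒≥ λ qy<qx →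
  NP.<⇒≱ (subst₂ F._<_ (FP.combine-remQuot {m} n y) (FP.combine-remQuot {m} n x)
            (FP.combine-monoˡ-< (remainder {m} n y) (remainder {m} n x) qy<qx)) x≤y

combine-cancelˡ-< : ∀ {m n} (t : Fin m) (i i′ : Fin n) → combine t i F.< combine t i′ → i F.< i′
combine-cancelˡ-< {m} {n} t i i′ lt = NP.+-cancelˡ-< (n * toℕ t) (toℕ i) (toℕ i′)
  (subst₂ _<_ (FP.toℕ-combine t i) (FP.toℕ-combine t i′) lt)

record AvoidingFamily (l n M : ℕ) : Set where
  field
    member   : Fin M → Fn n
    isPerm   : ∀ x → Injective _≡_ _≡_ (member x)
    avoids   : ∀ x → ¬ HasProgression l (member x)
    distinct : ∀ {x y} → (∀ i → member x i ≡ member y i) → x ≡ y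

avoidingFamily⇒θ≥ : ∀ {l n M} → AvoidingFamily l n M → θ≥ (suc l) n M
avoidingFamily⇒θ≥ {l} {n} {M} family =
  tabulate perm , perm-injective , λ x →
    subst (λ v → IsPerm v × AvoidsAP (suc l) v) (sym (lookup∘tabulate perm x)) (isPermutation x , avoidsAP x)
  where
  open AvoidingFamily family
  perm : Fin M → Vec (Fin n) n
  perm x = tabulate (member x)
  entries : ∀ x i → lookup (perm x) i ≡ member x i
  entries x = lookup∘tabulate (member x)
  isPermutation : ∀ x → IsPerm (perm x)
  isPermutation x {i} {j} eq = isPerm x (trans (sym (entries x i)) (trans eq (entries x j)))
  avoidsAP : ∀ x → AvoidsAP (suc l) (perm x)
  avoidsAP x = avoids x ∘ containsAP⇒hasProgression (member x)
  perm-injective : Injective _≡_ _≡_ (lookup (tabulate perm))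
  perm-injective {x} {y} eq = distinct λ i →
    trans (sym (entries x i)) (trans (cong (λ v → lookup v i) same) (entries y i))
    where
    same : perm x ≡ perm y
    same = trans (sym (lookup∘tabulate perm x)) (trans eq (lookup∘tabulate perm y))

-- The blow-up with factor q = p + 1 ≥ 1 (in the theorem p = k - 2), acting on
-- permutations avoiding (q+1)-term progressions.
module BlowUp (p : ℕ) where

  q : ℕ
  q = suc p

  module _ {n : ℕ} where

    block : Fin (q * n) → Fin q
    block = quotient n

    offset : Fin (q * n) → Fin n
    offset = remainder {q} n

    blowUp : Fn q → (Fin q → Fn n) → Fn (q * n)
    blowUp σ g x = cast (NP.*-comm n q) (combine (g (block x) (offset x)) (σ (block x)))

    toℕ-blowUp : ∀ σ g x → toℕ (blowUp σ g x) ≡ q * toℕ (g (block x) (offset x)) + toℕ (σ (block x))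
    toℕ-blowUp σ g x = trans (FP.toℕ-cast (NP.*-comm n q) _) (FP.toℕ-combine {n} {q} _ _)

    blowUp-combine : ∀ σ g t i → blowUp σ g (combine t i) ≡ cast (NP.*-comm n q) (combine (g t i) (σ t))
    blowUp-combine σ g t i =
      cong (λ (ti : Fin q × Fin n) → cast (NP.*-comm n q) (combine (g (proj₁ ti) (proj₂ ti)) (σ (proj₁ ti))))
           (FP.remQuot-combine t i)

    blowUp-permutation : ∀ σ g → Injective _≡_ _≡_ σ → (∀ t → Injective _≡_ _≡_ (g t)) →
      Injective _≡_ _≡_ (blowUp σ g)
    blowUp-permutation σ g σ-perm g-perm {x} {y} eq = remQuot-injective {q} n same-block same-offset
      where
      combined : combine (g (block x) (offset x)) (σ (block x)) ≡ combine (g (block y) (offset y)) (σ (block y))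
      combined = cast-injective (NP.*-comm n q) eq
      same-block : block x ≡ block y
      same-block = σ-perm (FP.combine-injectiveʳ {n} {q} _ _ _ _ combined)
      same-offset : offset x ≡ offset y
      same-offset = g-perm (block x)
        (trans (FP.combine-injectiveˡ {n} {q} _ _ _ _ combined) (cong (λ t → g t (offset y)) (sym same-block)))

    blowUp-determines : Fin n → ∀ {σ σ′ g g′} → (∀ x → blowUp σ g x ≡ blowUp σ′ g′ x) →
      (∀ t → σ t ≡ σ′ t) × (∀ t i → g t i ≡ g′ t i)
    blowUp-determines i₀ {σ} {σ′} {g} {g′} same =
      (λ t → FP.combine-injectiveʳ {n} {q} _ _ _ _ (at t i₀)) , (λ t i → FP.combine-injectiveˡ {n} {q} _ _ _ _ (at t i))
      where
      at : ∀ t i → combine (g t i) (σ t) ≡ combine (g′ t i) (σ′ t)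
      at t i = cast-injective (NP.*-comm n q)
        (trans (sym (blowUp-combine σ g t i)) (trans (same (combine t i)) (blowUp-combine σ′ g′ t i)))

    -- Along a (q+1)-term progression of σ[g] (σ injective) the first and last
    -- values differ by a multiple of q, so they have the same residue σ(t),
    -- hence the same block; as blocks are ordered, all terms share one block.
    progression-in-one-block : ∀ σ g → Injective _≡_ _≡_ σ →
      ∀ (idx : Fin (suc q) → Fin (q * n)) → Increasing idx → ∀ A B →
      (∀ j → toℕ (blowUp σ g (idx j)) + toℕ j * A ≡ toℕ (blowUp σ g (idx F.zero)) + toℕ j * B) →
      ∀ j → block (idx j) ≡ block (idx F.zero)
    progression-in-one-block σ g σ-perm idx incr A B prog j =
      FP.≤-antisym
        (FP.≤-trans (quotient-monotone n (increasing-monotone incr (FP.≤fromℕ j))) (FP.≤-reflexive last-in-first-block))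
        (quotient-monotone n (increasing-monotone incr {F.zero} {j} z≤n))
      where
      first last : Fin (q * n)
      first = idx F.zero
      last = idx (F.fromℕ q)
      W R : Fin (q * n) → ℕ
      W x = toℕ (g (block x) (offset x))
      R x = toℕ (σ (block x))
      endpoints : R last + (W last + A) * q ≡ R first + (W first + B) * q
      endpoints = begin
        R last + (W last + A) * q              ≡⟨ residueForm q (W last) (R last) A ⟨
        q * W last + R last + q * A            ≡⟨ cong₂ (λ u v → u + v * A) (sym (toℕ-blowUp σ g last)) (sym (FP.toℕ-fromℕ q)) ⟩
        toℕ (blowUp σ g last) + toℕ (F.fromℕ q) * A   ≡⟨ prog (F.fromℕ q) ⟩
        toℕ (blowUp σ g first) + toℕ (F.fromℕ q) * B  ≡⟨ cong₂ (λ u v → u + v * B) (toℕ-blowUp σ g first) (FP.toℕ-fromℕ q) ⟩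
        q * W first + R first + q * B          ≡⟨ residueForm q (W first) (R first) B ⟩
        R first + (W first + B) * q            ∎
        where open ≡-Reasoning
      last-in-first-block : block last ≡ block first
      last-in-first-block = σ-perm (FP.toℕ-injective
        (residues-equal q (W last + A) (W first + B) (FP.toℕ<n _) (FP.toℕ<n _) endpoints))

    -- If σ is a permutation and every g_t avoids (q+1)-term progressions,
    -- so does σ[g]: a progression lies in one block t₀, where the values are
    -- q·g_{t₀}(i) + σ(t₀), and dividing by q leaves a progression in g_{t₀}.
    blowUp-avoids : ∀ σ g → Injective _≡_ _≡_ σ → (∀ t → ¬ HasProgression q (g t)) →
      ¬ HasProgression q (blowUp σ g)
    blowUp-avoids σ g σ-perm g-avoids (idx , incr , A , B , A≢B , prog) =
      g-avoids t₀ (offset ∘ idx , offsets-increasing , W F.zero , W (F.suc F.zero) ,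
                   progression-quotient q W A B A≢B scaled)
      where
      t₀ : Fin q
      t₀ = block (idx F.zero)
      one-block : ∀ j → block (idx j) ≡ t₀
      one-block = progression-in-one-block σ g σ-perm idx incr A B prog
      W : Fin (suc q) → ℕ
      W j = toℕ (g t₀ (offset (idx j)))
      position : ∀ j → idx j ≡ combine t₀ (offset (idx j))
      position j = trans (sym (FP.combine-remQuot {q} n (idx j))) (cong (λ t → combine t (offset (idx j))) (one-block j))
      offsets-increasing : Increasing (offset ∘ idx)
      offsets-increasing j j′ j<j′ =
        combine-cancelˡ-< t₀ _ _ (subst₂ F._<_ (position j) (position j′) (incr j j′ j<j′))
      value : ∀ j → toℕ (blowUp σ g (idx j)) ≡ q * W j + toℕ (σ t₀)
      value j = trans (toℕ-blowUp σ g (idx j))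
                      (cong (λ t → q * toℕ (g t (offset (idx j))) + toℕ (σ t)) (one-block j))
      scaled : ∀ j → q * W j + toℕ j * A ≡ q * W F.zero + toℕ j * B
      scaled j = NP.+-cancelʳ-≡ (toℕ (σ t₀)) _ _ (begin
        q * W j + toℕ j * A + toℕ (σ t₀)           ≡⟨ xy∙z≈xz∙y (q * W j) _ _ ⟩
        q * W j + toℕ (σ t₀) + toℕ j * A           ≡⟨ cong (λ z → z + toℕ j * A) (value j) ⟨
        toℕ (blowUp σ g (idx j)) + toℕ j * A       ≡⟨ prog j ⟩
        toℕ (blowUp σ g (idx F.zero)) + toℕ j * B  ≡⟨ cong (λ z → z + toℕ j * B) (value F.zero) ⟩
        q * W F.zero + toℕ (σ t₀) + toℕ j * B      ≡⟨ xy∙z≈xz∙y (q * W F.zero) _ _ ⟩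
        q * W F.zero + toℕ j * B + toℕ (σ t₀)      ∎)
        where open ≡-Reasoning

  trivialFamily : AvoidingFamily q 1 1
  trivialFamily = record
    { member = λ _ → id ; isPerm = λ _ → id ; avoids = λ _ → noTwoPositions ; distinct = singleton }
    where
    noTwoPositions : ¬ HasProgression q {1} id
    noTwoPositions (idx , incr , _) with idx F.zero | idx (F.suc F.zero) | incr F.zero (F.suc F.zero) (s≤s z≤n)
    ... | F.zero | F.zero | ()
    singleton : ∀ {x y : Fin 1} → (∀ (i : Fin 1) → i ≡ i) → x ≡ y
    singleton {F.zero} {F.zero} _ = refl

  -- From M avoiding permutations of Fin n (n > 0) the blow-ups σ[g], with σ
  -- one of the q! permutations of Fin q and g one of the M^q choices of
  -- pieces, form q!·M^q distinct avoiding permutations of Fin (q·n).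
  blowUpFamily : ∀ {n M} → Fin n → AvoidingFamily q n M → AvoidingFamily q (q * n) (q ! * M ^ q)
  blowUpFamily {n} {M} i₀ family = record
    { member   = λ x → blowUp (outer x) (inner x)
    ; isPerm   = λ x → blowUp-permutation (outer x) (inner x) (lehmer-permutation q _) (isPerm ∘ piece x)
    ; avoids   = λ x → blowUp-avoids (outer x) (inner x) (lehmer-permutation q _) (avoids ∘ piece x)
    ; distinct = distinct′
    }
    where
    open AvoidingFamily family
    outer : Fin (q ! * M ^ q) → Fn q
    outer x = lehmer q (quotient (M ^ q) x)
    piece : Fin (q ! * M ^ q) → Fin q → Fin M
    piece x = finToFun (remainder {q !} (M ^ q) x)
    inner : Fin (q ! * M ^ q) → Fin q → Fn n
    inner x t = member (piece x t)
    distinct′ : ∀ {x y} → (∀ i → blowUp (outer x) (inner x) i ≡ blowUp (outer y) (inner y) i) → x ≡ y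
    distinct′ same with blowUp-determines i₀ same
    ... | same-outer , same-inner = remQuot-injective {q !} (M ^ q)
      (lehmer-injective q same-outer) (finToFun-injective λ t → distinct (same-inner t))

  -- levels m = (q^m - 1)/(q - 1): the exponent of q! in the number of
  -- permutations produced by m blow-ups.
  levels : ℕ → ℕ
  levels zero    = 0
  levels (suc m) = suc (q * levels m)

  levels-closed : ∀ m → levels m * p + 1 ≡ q ^ m
  levels-closed zero    = refl
  levels-closed (suc m) = trans (unfold p (levels m)) (cong (q *_) (levels-closed m))
    where
    unfold : ∀ p e → (1 + (1 + p) * e) * p + 1 ≡ (1 + p) * (e * p + 1)
    unfold = solve-∀

  iteratedFamily : ∀ m → AvoidingFamily q (q ^ m) ((q !) ^ levels m)
  iteratedFamily zero    = trivialFamily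
  iteratedFamily (suc m) =
    subst (AvoidingFamily q (q ^ suc m)) count (blowUpFamily (F.fromℕ< (NP.m^n>0 q m)) (iteratedFamily m))
    where
    count : q ! * ((q !) ^ levels m) ^ q ≡ (q !) ^ levels (suc m)
    count = cong ((q !) *_) (trans (NP.^-*-assoc (q !) (levels m) q) (cong ((q !) ^_) (NP.*-comm (levels m) q)))

-- If e·p + 1 = n, b ≤ n and a, p > 0, then F^(e·b·p) already exceeds
-- F^((1/p - a/b)·n), in the cleared-denominator form used by the statement.
exponent-bound : ∀ F .{{_ : NonZero F}} a b p n e → 0 < a → 0 < p → b ≤ n → e * p + 1 ≡ n →
  F ^ (b * n ∸ a * p * n) ≤ (F ^ e) ^ (b * p) * F ^ (a * p * n ∸ b * n)
exponent-bound F a@(suc _) b p@(suc _) n e _ _ b≤n n≡ = begin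
  F ^ (b * n ∸ a * p * n)       ≤⟨ NP.^-monoʳ-≤ F exponents ⟩
  F ^ (e * (b * p))             ≡⟨ NP.^-*-assoc F e (b * p) ⟨
  (F ^ e) ^ (b * p)             ≤⟨ NP.m≤m*n _ _ {{NP.m^n≢0 F (a * p * n ∸ b * n)}} ⟩
  (F ^ e) ^ (b * p) * F ^ (a * p * n ∸ b * n) ∎
  where
  open NP.≤-Reasoning
  exponents : b * n ∸ a * p * n ≤ e * (b * p)
  exponents = NP.≤-trans (NP.∸-monoʳ-≤ (b * n) (NP.≤-trans b≤n (NP.m≤n*m n (a * p)))) (NP.≤-reflexive (begin-equality
    b * n ∸ b                   ≡⟨ cong (λ m → b * m ∸ b) n≡ ⟨
    b * (e * p + 1) ∸ b         ≡⟨ cong (_∸ b) (expand b e p) ⟩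
    e * (b * p) + b ∸ b         ≡⟨ NP.m+n∸n≡m (e * (b * p)) b ⟩
    e * (b * p)                 ∎))
    where
    expand : ∀ b e p → b * (e * p + 1) ≡ e * (b * p) + b
    expand = solve-∀

mainTheorem7 : (k : ℕ) → 3 ≤ k → (a b : ℕ) → 0 < a → 0 < b →
    ∃[ N ] (∀ m → N ≤ (k ∸ 1) ^ m → BoundHolds k a b ((k ∸ 1) ^ m))
mainTheorem7 (suc zero) (s≤s ())
mainTheorem7 (suc (suc zero)) (s≤s (s≤s ()))
mainTheorem7 (suc (suc (suc r))) _ a b 0<a _ =
  b , λ m b≤n → (q !) ^ levels m , avoidingFamily⇒θ≥ (iteratedFamily m) ,
    exponent-bound (q !) {{NP._!≢0 q}} a b p (q ^ m) (levels m) 0<a (s≤s z≤n) b≤n (levels-closed m)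
  where
  p : ℕ
  p = suc r
  open BlowUp p
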